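{- Let $n\ge 1$ and write $n=d_1d_2\cdots d_k$ with primes $d_1\le d_2\le\cdots\le d_k$. A longest directed path in the directed power graph of $\mathbb{Z}/n\mathbb{Z}$ has the following form: first all $\varphi(n)$ generators of $\mathbb{Z}/n\mathbb{Z}$, then all $\varphi(n/d_1)$ generators of the subgroup $d_1\mathbb{Z}/n\mathbb{Z}$ (of order $n/d_1$), then all $\varphi(n/(d_1d_2))$ generators of the subgroup $d_1d_2\mathbb{Z}/n\mathbb{Z}$, and so on, ending with the identity (the generator of $d_1\cdots d_k\mathbb{Z}/n\mathbb{Z}=\{0\}$).
   Context: The directed power graph of a group $G$ has vertex set $G$ and a directed edge $(x,y)$ whenever $x\ne y$ and $\langle y\rangle\le\langle x\rangle$. A directed path is a sequence of distinct vertices each joined to the next by a directed edge; its length is measured by its number of vertices. $\varphi$ is Euler's totient function. -}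

module Defs where

open import Data.Nat using (ℕ; zero; suc; _*_; _≤_; NonZero)
open import Data.Nat.DivMod using (_%_; _/_)
open import Data.Nat.Divisibility using (_∣_)
open import Data.Nat.GCD using (gcd)
open import Data.Nat.Primality using (Prime)
open import Data.Fin using (Fin; toℕ)
open import Data.List using (List; length; filter; upTo; take; concat; tabulate)
open import Data.Nat.ListAction using (product)
open import Data.List.Relation.Unary.All using (All)
open import Data.List.Relation.Unary.Linked using (Linked)
open import Data.List.Relation.Unary.Unique.Propositional using (Unique)
open import Data.List.Membership.Propositional using (_∈_)
open import Data.Product using (_×_; ∃-syntax)
open import Relation.Binary.PropositionalEquality using (_≡_; _≢_)
open import Relation.Nullary.Decidable using (does)
open import Data.Nat using (_≟_)
open import Function.Bundles using (_⇔_)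

-- Euler's totient: number of m with 0 ≤ m < n and gcd m n = 1
-- (for n = 1 this counts m = 0, giving φ 1 = 1; for n > 1, m = 0 is excluded
--  since gcd 0 n = n).
φ : ℕ → ℕ
φ n = length (filter (λ m → gcd m n ≟ 1) (upTo n))

-- n / m, with a junk value 0 for m = 0 (never used at m = 0 below).
_div_ : ℕ → ℕ → ℕ
n div zero = 0
n div suc m = n / suc m

module _ (n : ℕ) .{{_ : NonZero n}} where

  InCyclic : Fin n → Fin n → Set
  InCyclic x y = ∃[ k ] ((k * toℕ x) % n ≡ toℕ y)

  Edge : Fin n → Fin n → Set
  Edge x y = x ≢ y × (∀ z → InCyclic y z → InCyclic x z)

  IsDirectedPath : List (Fin n) → Set
  IsDirectedPath p = Unique p × Linked Edge p

  InSub : ℕ → Fin n → Set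
  InSub d x = d ∣ toℕ x

  IsGenOf : ℕ → Fin n → Set
  IsGenOf d g = ∀ z → InCyclic g z ⇔ InSub d z

IsPrimeFactorization : List ℕ → ℕ → Set
IsPrimeFactorization ds n = All Prime ds × Linked _≤_ ds × product ds ≡ n

prefixProd : (ds : List ℕ) → Fin (suc (length ds)) → ℕ
prefixProd ds i = product (take (toℕ i) ds)

BlocksOk : (n : ℕ) .{{_ : NonZero n}} (ds : List ℕ) →
           (Fin (suc (length ds)) → List (Fin n)) → Set
BlocksOk n ds blocks =
  ∀ i → Unique (blocks i) × (∀ x → (x ∈ blocks i) ⇔ IsGenOf n (prefixProd ds i) x)

pathOf : ∀ {n k} → (Fin (suc k) → List (Fin n)) → List (Fin n)
pathOf blocks = concat (tabulate blocks)

-- In ℤ/nℤ the cyclic subgroup ⟨x⟩ is determined by its index gcd x n, and ⟨y⟩ ≤ ⟨x⟩ iff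
-- gcd x n ∣ gcd y n; so a directed path is a list of distinct residues whose indices form a
-- divisibility chain, and exactly φ (n / c) residues have index c. Removing from a path its
-- residues of lowest index c leaves a path of lowest index c′, a proper multiple of c with
-- n / c′ the product of a proper sub-multiset of the primes of n / c. Hence a path has length
-- at most φ (p₁ ⋯ pₖ) + φ (p₂ ⋯ pₖ) + ⋯ + φ 1 for the primes p₁ ≤ ⋯ ≤ pₖ of n, since discarding
-- the smaller primes first is optimal: φ (p t) ≤ p φ t ≤ (q − 1) φ t ≤ φ (q t) for p < q, q prime.
-- The generators of the subgroups d₁ ⋯ dᵢ ℤ/nℤ, listed block by block, attain this bound.

module Submission where

open import Data.Empty using (⊥; ⊥-elim)
open import Data.Fin using (Fin; toℕ; fromℕ<)
open import Data.Fin.Properties using (toℕ<n; toℕ-fromℕ<)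
open import Data.List
  using (List; []; _∷_; _++_; length; filter; applyUpTo; upTo; tabulate; allFin; map; concat; drop; take)
open import Data.List.Properties
  using (length-++; length-++-sucʳ; map-tabulate; tabulate-cong; length-take; take++drop≡id)
open import Data.List.Membership.Propositional using (_∈_)
open import Data.List.Membership.Propositional.Properties
  using (∈-∃++; ∈-++⁻; ∈-++⁺ˡ; ∈-++⁺ʳ; ∈-filter⁺; ∈-filter⁻; ∈-allFin)
open import Data.List.Relation.Binary.Equality.Propositional using (≋⇒≡)
open import Data.List.Relation.Binary.Sublist.Propositional using (_⊆_; []; _∷_; _∷ʳ_)
open import Data.List.Relation.Binary.Sublist.Propositional.Properties
  using (All-resp-⊆; length-mono-≤; to-≋; take⁺)
open import Data.List.Relation.Unary.All using (All; []; _∷_)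
import Data.List.Relation.Unary.All as All
import Data.List.Relation.Unary.All.Properties as Allₚ
open import Data.List.Relation.Unary.AllPairs using (AllPairs; []; _∷_)
import Data.List.Relation.Unary.AllPairs as AllPairs
import Data.List.Relation.Unary.AllPairs.Properties as AllPairsₚ
open import Data.List.Relation.Unary.Any using (here; there)
import Data.List.Relation.Unary.Linked as Linked
open import Data.List.Relation.Unary.Linked.Properties using (Linked⇒AllPairs; AllPairs⇒Linked)
open import Data.List.Relation.Unary.Unique.Propositional using (Unique)
import Data.List.Relation.Unary.Unique.Propositional.Properties as Uniqueₚ
open import Data.Nat
  using (ℕ; zero; suc; pred; _+_; _*_; _∸_; _≤_; _<_; z≤n; s≤s; s≤s⁻¹; z<s; s<s; _≟_;
         NonZero; >-nonZero; ≢-nonZero; ≢-nonZero⁻¹; nonTrivial⇒n>1)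
open import Data.Nat.Coprimality
  using (Coprime; coprime?; coprime⇒gcd≡1; gcd≡1⇒coprime; coprime-divisor)
open import Data.Nat.Divisibility
open import Data.Nat.DivMod using (_%_; %-distribˡ-*; [m+kn]%n≡m%n; m<n⇒m%n≡m; m*n/n≡m)
open import Data.Nat.GCD
  using (gcd; gcd[m,n]∣m; gcd[m,n]∣n; gcd-greatest; gcd-GCD; c*gcd[m,n]≡gcd[cm,cn]; module Bézout)
open import Data.Nat.Induction using (<-wellFounded)
open import Data.Nat.ListAction using (sum; product)
open import Data.Nat.ListAction.Properties using (product-++)
open import Data.Nat.Primality
  using (Prime; prime⇒irreducible; prime⇒nonTrivial; prime⇒nonZero; euclidsLemma; productOfPrimes≢0)
open import Data.Nat.Properties
open import Algebra.Properties.CommutativeSemigroup +-commutativeSemigroup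
  using () renaming (interchange to +-interchange; xy∙z≈xz∙y to +-right-comm)
open import Algebra.Properties.CommutativeSemigroup *-commutativeSemigroup
  using () renaming (x∙yz≈y∙xz to *-left-comm)
open import Data.Nat.Tactic.RingSolver using (solve-∀)
open import Data.Product using (_×_; _,_; proj₁; proj₂; ∃-syntax; Σ-syntax)
open import Data.Sum using (_⊎_; inj₁; inj₂)
open import Defs
open import Function using (_∘_; id; flip)
open import Function.Bundles using (_⇔_; mk⇔; Equivalence)
open import Induction.WellFounded using (Acc; acc)
open import Level using (Level)
open import Relation.Binary using (Rel)
open import Relation.Binary.PropositionalEquality
  using (_≡_; _≢_; refl; sym; trans; cong; cong₂; subst; subst₂; module ≡-Reasoning)
open import Relation.Nullary using (¬_; Dec; yes; no)
open import Relation.Unary using (Pred; Decidable)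
open import Relation.Unary.Properties using (∁?)

private
  variable
    a ℓ : Level
    A : Set a
    xs ys : List A

length-filter+∁ : {P : Pred A ℓ} (P? : Decidable P) (xs : List A) →
                  length (filter P? xs) + length (filter (∁? P?) xs) ≡ length xs
length-filter+∁ P? []       = refl
length-filter+∁ P? (x ∷ xs) with P? x
... | yes _ = cong suc (length-filter+∁ P? xs)
... | no _  = trans (+-suc _ _) (cong suc (length-filter+∁ P? xs))

length-filter-map : {B : Set a} {P : Pred B ℓ} (P? : Decidable P) (f : A → B) (xs : List A) →
                    length (filter P? (map f xs)) ≡ length (filter (P? ∘ f) xs)
length-filter-map P? f []       = refl
length-filter-map P? f (x ∷ xs) with P? (f x)
... | yes _ = cong suc (length-filter-map P? f xs)
... | no _  = length-filter-map P? f xs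

tabulate-toℕ : (f : ℕ → A) (k : ℕ) → tabulate {n = k} (f ∘ toℕ) ≡ applyUpTo f k
tabulate-toℕ f zero    = refl
tabulate-toℕ f (suc k) = cong (f 0 ∷_) (tabulate-toℕ (f ∘ suc) k)

length-filter-allFin : {P : Pred ℕ ℓ} (P? : Decidable P) (n : ℕ) →
                       length (filter (P? ∘ toℕ) (allFin n)) ≡ length (filter P? (upTo n))
length-filter-allFin P? n = begin
  length (filter (P? ∘ toℕ) (allFin n))      ≡⟨ length-filter-map P? toℕ (allFin n) ⟨
  length (filter P? (map toℕ (allFin n)))    ≡⟨ cong (length ∘ filter P?) (map-tabulate {n = n} id toℕ) ⟩
  length (filter P? (tabulate {n = n} toℕ))  ≡⟨ cong (length ∘ filter P?) (tabulate-toℕ id n) ⟩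
  length (filter P? (upTo n))                ∎
  where open ≡-Reasoning

Unique⇒length-≤ : {xs ys : List A} → Unique xs → (∀ {x} → x ∈ xs → x ∈ ys) → length xs ≤ length ys
Unique⇒length-≤ {xs = []}     _                   _     = z≤n
Unique⇒length-≤ {xs = x ∷ xs} (x∉xs ∷ xs-unique) xs⊆ys with ∈-∃++ (xs⊆ys (here refl))
... | us , vs , refl = begin
  suc (length xs)           ≤⟨ s≤s (Unique⇒length-≤ xs-unique xs⊆us++vs) ⟩
  suc (length (us ++ vs))   ≡⟨ length-++-sucʳ us x vs ⟨
  length (us ++ x ∷ vs)     ∎
  where
  open ≤-Reasoning
  xs⊆us++vs : ∀ {y} → y ∈ xs → y ∈ us ++ vs
  xs⊆us++vs y∈xs with ∈-++⁻ us (xs⊆ys (there y∈xs))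
  ... | inj₁ y∈us         = ∈-++⁺ˡ y∈us
  ... | inj₂ (here refl)  = ⊥-elim (All.lookup x∉xs y∈xs refl)
  ... | inj₂ (there y∈vs) = ∈-++⁺ʳ us y∈vs

length-concat : (xss : List (List A)) → length (concat xss) ≡ sum (map length xss)
length-concat []         = refl
length-concat (xs ∷ xss) = trans (length-++ xs) (cong (length xs +_) (length-concat xss))

All⇒AllPairs : {P : Pred A ℓ} → All P xs → AllPairs (λ x y → P x × P y) xs
All⇒AllPairs []         = []
All⇒AllPairs (px ∷ pxs) = All.map (px ,_) pxs ∷ All⇒AllPairs pxs

AllPairs-resp-⊆ : {R : Rel A ℓ} → xs ⊆ ys → AllPairs R ys → AllPairs R xs
AllPairs-resp-⊆ []         []           = []
AllPairs-resp-⊆ (_ ∷ʳ xs⊆ys) (_ ∷ rys)   = AllPairs-resp-⊆ xs⊆ys rys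
AllPairs-resp-⊆ (refl ∷ xs⊆ys) (ry ∷ rys) = All-resp-⊆ xs⊆ys ry ∷ AllPairs-resp-⊆ xs⊆ys rys

⊆-length-< : xs ⊆ ys → xs ≢ ys → length xs < length ys
⊆-length-< xs⊆ys xs≢ys with m≤n⇒m<n∨m≡n (length-mono-≤ xs⊆ys)
... | inj₁ lt = lt
... | inj₂ eq = ⊥-elim (xs≢ys (≋⇒≡ (to-≋ eq xs⊆ys)))

prime⇒>1 : ∀ {q} → Prime q → 1 < q
prime⇒>1 {q} q-prime = nonTrivial⇒n>1 q {{prime⇒nonTrivial q-prime}}

nonZero-factorʳ : ∀ {m d n} .{{_ : NonZero n}} → m * d ≡ n → NonZero d
nonZero-factorʳ {m} {n = n} m*d≡n = ≢-nonZero λ { refl → ≢-nonZero⁻¹ n (trans (sym m*d≡n) (*-zeroʳ m)) }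

-- Finite sums

∑ : ℕ → (ℕ → ℕ) → ℕ
∑ zero    f = 0
∑ (suc k) f = f 0 + ∑ k (f ∘ suc)

syntax ∑ k (λ i → e) = ∑[ i < k ] e

∑-cong : ∀ k {f g : ℕ → ℕ} → (∀ i → i < k → f i ≡ g i) → ∑ k f ≡ ∑ k g
∑-cong zero    eq = refl
∑-cong (suc k) eq = cong₂ _+_ (eq 0 z<s) (∑-cong k (λ i i<k → eq (suc i) (s<s i<k)))

∑-mono-≤ : ∀ k {f g : ℕ → ℕ} → (∀ i → i < k → f i ≤ g i) → ∑ k f ≤ ∑ k g
∑-mono-≤ zero    le = z≤n
∑-mono-≤ (suc k) le = +-mono-≤ (le 0 z<s) (∑-mono-≤ k (λ i i<k → le (suc i) (s<s i<k)))

∑-const : ∀ k c → ∑[ _ < k ] c ≡ k * c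
∑-const zero    c = refl
∑-const (suc k) c = cong (c +_) (∑-const k c)

∑-distrib-+ : ∀ k (f g : ℕ → ℕ) → ∑[ i < k ] (f i + g i) ≡ ∑ k f + ∑ k g
∑-distrib-+ zero    f g = refl
∑-distrib-+ (suc k) f g = begin
  f 0 + g 0 + ∑[ i < k ] (f (suc i) + g (suc i))  ≡⟨ cong (f 0 + g 0 +_) (∑-distrib-+ k (f ∘ suc) (g ∘ suc)) ⟩
  f 0 + g 0 + (∑ k (f ∘ suc) + ∑ k (g ∘ suc))    ≡⟨ +-interchange (f 0) (g 0) _ _ ⟩
  f 0 + ∑ k (f ∘ suc) + (g 0 + ∑ k (g ∘ suc))    ∎
  where open ≡-Reasoning

*-distribˡ-∑ : ∀ c k (f : ℕ → ℕ) → c * ∑ k f ≡ ∑[ i < k ] (c * f i)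
*-distribˡ-∑ c zero    f = *-zeroʳ c
*-distribˡ-∑ c (suc k) f = trans (*-distribˡ-+ c (f 0) _) (cong (c * f 0 +_) (*-distribˡ-∑ c k (f ∘ suc)))

∑-+ : ∀ m k (f : ℕ → ℕ) → ∑ (m + k) f ≡ ∑ m f + ∑[ i < k ] f (m + i)
∑-+ zero    k f = refl
∑-+ (suc m) k f = trans (cong (f 0 +_) (∑-+ m k (f ∘ suc))) (sym (+-assoc (f 0) _ _))

∑-* : ∀ q t (f : ℕ → ℕ) → ∑ (q * t) f ≡ ∑[ j < q ] ∑[ r < t ] f (j * t + r)
∑-* zero    t f = refl
∑-* (suc q) t f = begin
  ∑ (t + q * t) f                                          ≡⟨ ∑-+ t (q * t) f ⟩
  ∑ t f + ∑[ i < q * t ] f (t + i)                          ≡⟨ cong (∑ t f +_) (∑-* q t (λ i → f (t + i))) ⟩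
  ∑ t f + ∑[ j < q ] ∑[ r < t ] f (t + (j * t + r))         ≡⟨ cong (∑ t f +_) (∑-cong q λ j _ → ∑-cong t λ r _ →
                                                                 cong f (sym (+-assoc t (j * t) r))) ⟩
  ∑ t f + ∑[ j < q ] ∑[ r < t ] f (t + j * t + r)           ∎
  where open ≡-Reasoning

∑-comm : ∀ p q (f : ℕ → ℕ → ℕ) → ∑[ j < p ] ∑[ r < q ] f j r ≡ ∑[ r < q ] ∑[ j < p ] f j r
∑-comm zero    q f = sym (trans (∑-const q 0) (*-zeroʳ q))
∑-comm (suc p) q f = trans (cong (∑[ r < q ] f 0 r +_) (∑-comm p q (f ∘ suc)))
                           (sym (∑-distrib-+ q (f 0) (λ r → ∑[ j < p ] f (suc j) r)))

𝟙 : {P : Set a} → Dec P → ℕ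
𝟙 (yes _) = 1
𝟙 (no _)  = 0

𝟙-mono-≤ : {P Q : Set a} (P? : Dec P) (Q? : Dec Q) → (P → Q) → 𝟙 P? ≤ 𝟙 Q?
𝟙-mono-≤ (yes p) (yes _) _   = ≤-refl
𝟙-mono-≤ (yes p) (no ¬q) p⇒q = ⊥-elim (¬q (p⇒q p))
𝟙-mono-≤ (no _)  _       _   = z≤n

𝟙-cong : {P Q : Set a} (P? : Dec P) (Q? : Dec Q) → (P → Q) → (Q → P) → 𝟙 P? ≡ 𝟙 Q?
𝟙-cong P? Q? p⇒q q⇒p = ≤-antisym (𝟙-mono-≤ P? Q? p⇒q) (𝟙-mono-≤ Q? P? q⇒p)

𝟙-yes : {P : Set a} (P? : Dec P) → P → 𝟙 P? ≡ 1
𝟙-yes (yes _) _ = refl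
𝟙-yes (no ¬p) p = ⊥-elim (¬p p)

𝟙-no : {P : Set a} (P? : Dec P) → ¬ P → 𝟙 P? ≡ 0
𝟙-no (yes p) ¬p = ⊥-elim (¬p p)
𝟙-no (no _)  _  = refl

length-filter-applyUpTo : {P : Pred A ℓ} (P? : Decidable P) (f : ℕ → A) (k : ℕ) →
                          length (filter P? (applyUpTo f k)) ≡ ∑[ i < k ] 𝟙 (P? (f i))
length-filter-applyUpTo P? f zero = refl
length-filter-applyUpTo P? f (suc k) with P? (f 0)
... | yes _ = cong suc (length-filter-applyUpTo P? (f ∘ suc) k)
... | no _  = length-filter-applyUpTo P? (f ∘ suc) k

∑𝟙-all : {P : Pred ℕ ℓ} (P? : Decidable P) (k : ℕ) → (∀ i → i < k → P i) → ∑[ i < k ] 𝟙 (P? i) ≡ k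
∑𝟙-all P? zero    _   = refl
∑𝟙-all P? (suc k) all = cong₂ _+_ (𝟙-yes (P? 0) (all 0 z<s)) (∑𝟙-all (P? ∘ suc) k (λ i i<k → all (suc i) (s<s i<k)))

pred≤∑𝟙 : {P : Pred ℕ ℓ} (P? : Decidable P) (k : ℕ) →
          (∀ i j → i < j → j < k → P i ⊎ P j) → pred k ≤ ∑[ i < k ] 𝟙 (P? i)
pred≤∑𝟙 P? k one = pred-mono-≤ (≤1+∑𝟙 P? k one)
  where
  ≤1+∑𝟙 : {P : Pred ℕ ℓ} (P? : Decidable P) (k : ℕ) →
          (∀ i j → i < j → j < k → P i ⊎ P j) → k ≤ suc (∑[ i < k ] 𝟙 (P? i))
  ≤1+∑𝟙 P? zero    _   = z≤n
  ≤1+∑𝟙 {P = P} P? (suc k) one with P? 0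
  ... | yes _  = s≤s (≤1+∑𝟙 (P? ∘ suc) k (λ i j i<j j<k → one (suc i) (suc j) (s<s i<j) (s<s j<k)))
  ... | no ¬p₀ = s≤s (≤-reflexive (sym (∑𝟙-all (P? ∘ suc) k rest)))
    where
    rest : ∀ i → i < k → P (suc i)
    rest i i<k with one 0 (suc i) z<s (s<s i<k)
    ... | inj₁ p₀ = ⊥-elim (¬p₀ p₀)
    ... | inj₂ pᵢ = pᵢ

-- Euler's totient function

coprime-+-*⁻ : ∀ {r t} j p → Coprime (j * t + r) (p * t) → Coprime r t
coprime-+-*⁻ j p x⊥pt (d∣r , d∣t) = x⊥pt (∣m∣n⇒∣m+n (∣n⇒∣m*n j d∣t) d∣r , ∣n⇒∣m*n p d∣t)

coprime-+-* : ∀ {r t} j → Coprime r t → Coprime (j * t + r) t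
coprime-+-* j r⊥t (d∣x , d∣t) = r⊥t (∣m+n∣m⇒∣n d∣x (∣n⇒∣m*n j d∣t) , d∣t)

∤⇒coprime : ∀ {q x} → Prime q → ¬ q ∣ x → Coprime x q
∤⇒coprime q-prime q∤x (f∣x , f∣q) with prime⇒irreducible q-prime f∣q
... | inj₁ f≡1  = f≡1
... | inj₂ refl = ⊥-elim (q∤x f∣x)

coprime-*ˡ : ∀ {q x t} → Prime q → ¬ q ∣ x → Coprime x t → Coprime x (q * t)
coprime-*ˡ q-prime q∤x x⊥t (e∣x , e∣qt) =
  x⊥t (e∣x , coprime-divisor (∤⇒coprime q-prime (q∤x ∘ flip ∣-trans e∣x)) e∣qt)

-- q would divide (j − i) t, yet neither 0 < j − i < q nor t (as q ∤ r and gcd r t = 1).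
prime-∣-+-*-unique : ∀ {q r t i j} → Prime q → Coprime r t → i < j → j < q →
                     q ∣ i * t + r → q ∣ j * t + r → ⊥
prime-∣-+-*-unique {q} {r} {t} {i} {j} q-prime r⊥t i<j j<q q∣x q∣y
  with euclidsLemma (j ∸ i) t q-prime q∣[j∸i]t
  where
  shift : i * t + r + (j ∸ i) * t ≡ j * t + r
  shift = trans (+-right-comm (i * t) r _)
                (cong (_+ r) (trans (cong (i * t +_) (*-distribʳ-∸ t j i)) (m+[n∸m]≡n (*-monoˡ-≤ t (<⇒≤ i<j)))))
  q∣[j∸i]t : q ∣ (j ∸ i) * t
  q∣[j∸i]t = ∣m+n∣m⇒∣n (subst (q ∣_) (sym shift) q∣y) q∣x
... | inj₁ q∣j∸i = <⇒≱ (≤-<-trans (m∸n≤m j i) j<q) (∣⇒≤ {{>-nonZero (m<n⇒0<n∸m i<j)}} q∣j∸i)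
... | inj₂ q∣t  = <⇒≢ (prime⇒>1 q-prime) (sym (r⊥t (∣m+n∣m⇒∣n q∣x (∣n⇒∣m*n i q∣t) , q∣t)))

φ≡∑𝟙 : ∀ n → φ n ≡ ∑[ x < n ] 𝟙 (coprime? x n)
φ≡∑𝟙 n = trans (length-filter-applyUpTo (λ m → gcd m n ≟ 1) id n)
               (∑-cong n λ x _ → 𝟙-cong (gcd x n ≟ 1) (coprime? x n) gcd≡1⇒coprime coprime⇒gcd≡1)

φ[p*t]≤p*φ[t] : ∀ p t → φ (p * t) ≤ p * φ t
φ[p*t]≤p*φ[t] p t = begin
  φ (p * t)                                                ≡⟨ φ≡∑𝟙 (p * t) ⟩
  ∑[ x < p * t ] 𝟙 (coprime? x (p * t))                    ≡⟨ ∑-* p t _ ⟩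
  ∑[ j < p ] ∑[ r < t ] 𝟙 (coprime? (j * t + r) (p * t))   ≤⟨ ∑-mono-≤ p (λ j _ → ∑-mono-≤ t λ r _ →
                                                                 𝟙-mono-≤ (coprime? _ _) (coprime? r t) (coprime-+-*⁻ j p)) ⟩
  ∑[ j < p ] ∑[ r < t ] 𝟙 (coprime? r t)                   ≡⟨ ∑-const p _ ⟩
  p * ∑[ r < t ] 𝟙 (coprime? r t)                          ≡⟨ cong (p *_) (φ≡∑𝟙 t) ⟨
  p * φ t                                                  ∎
  where open ≤-Reasoning

pred[q]*φ[t]≤φ[q*t] : ∀ {q} → Prime q → ∀ t → pred q * φ t ≤ φ (q * t)
pred[q]*φ[t]≤φ[q*t] {q} q-prime t = begin
  pred q * φ t                                             ≡⟨ cong (pred q *_) (φ≡∑𝟙 t) ⟩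
  pred q * ∑[ r < t ] 𝟙 (coprime? r t)                     ≡⟨ *-distribˡ-∑ (pred q) t _ ⟩
  ∑[ r < t ] (pred q * 𝟙 (coprime? r t))                   ≤⟨ ∑-mono-≤ t (λ r _ → column r) ⟩
  ∑[ r < t ] ∑[ j < q ] 𝟙 (coprime? (j * t + r) (q * t))   ≡⟨ ∑-comm q t _ ⟨
  ∑[ j < q ] ∑[ r < t ] 𝟙 (coprime? (j * t + r) (q * t))   ≡⟨ ∑-* q t _ ⟨
  ∑[ x < q * t ] 𝟙 (coprime? x (q * t))                    ≡⟨ φ≡∑𝟙 (q * t) ⟨
  φ (q * t)                                                ∎
  where
  open ≤-Reasoning
  column : ∀ r → pred q * 𝟙 (coprime? r t) ≤ ∑[ j < q ] 𝟙 (coprime? (j * t + r) (q * t))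
  column r with coprime? r t
  ... | no _     = ≤-trans (≤-reflexive (*-zeroʳ (pred q))) z≤n
  ... | yes r⊥t = ≤-trans (≤-reflexive (*-identityʳ (pred q)))
                          (pred≤∑𝟙 (λ j → coprime? (j * t + r) (q * t)) q one-of-any-two)
    where
    coprime-unless-∣ : ∀ j → ¬ q ∣ j * t + r → Coprime (j * t + r) (q * t)
    coprime-unless-∣ j q∤ = coprime-*ˡ q-prime q∤ (coprime-+-* j r⊥t)
    one-of-any-two : ∀ i j → i < j → j < q → Coprime (i * t + r) (q * t) ⊎ Coprime (j * t + r) (q * t)
    one-of-any-two i j i<j j<q with q ∣? i * t + r
    ... | no q∤x  = inj₁ (coprime-unless-∣ i q∤x)
    ... | yes q∣x = inj₂ (coprime-unless-∣ j (prime-∣-+-*-unique q-prime r⊥t i<j j<q q∣x))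

φ[p*t]≤φ[q*t] : ∀ {p q} → Prime q → p ≤ q → ∀ t → φ (p * t) ≤ φ (q * t)
φ[p*t]≤φ[q*t] {p} {q} q-prime p≤q t with m≤n⇒m<n∨m≡n p≤q
... | inj₂ refl = ≤-refl
... | inj₁ p<q  = begin
  φ (p * t)     ≤⟨ φ[p*t]≤p*φ[t] p t ⟩
  p * φ t       ≤⟨ *-monoˡ-≤ (φ t) (<⇒≤pred p<q) ⟩
  pred q * φ t  ≤⟨ pred[q]*φ[t]≤φ[q*t] q-prime t ⟩
  φ (q * t)     ∎
  where open ≤-Reasoning

φ[t]≤φ[q*t] : ∀ {q} → Prime q → ∀ t → φ t ≤ φ (q * t)
φ[t]≤φ[q*t] {q} q-prime t =
  subst (_≤ φ (q * t)) (cong φ (*-identityˡ t)) (φ[p*t]≤φ[q*t] q-prime (<⇒≤ (prime⇒>1 q-prime)) t)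

-- Writing x = u c + r with r < c, gcd x (m c) = c forces r = 0 and then says gcd u m = 1.
#[gcd≡c]≡φ : ∀ m c .{{_ : NonZero c}} →
             length (filter (λ x → gcd x (m * c) ≟ c) (upTo (m * c))) ≡ φ m
#[gcd≡c]≡φ m c@(suc c′) = begin
  length (filter (λ x → gcd x (m * c) ≟ c) (upTo (m * c)))  ≡⟨ length-filter-applyUpTo _ id (m * c) ⟩
  ∑[ x < m * c ] 𝟙 (gcd x (m * c) ≟ c)                       ≡⟨ ∑-* m c _ ⟩
  ∑[ u < m ] ∑[ r < c ] 𝟙 (gcd (u * c + r) (m * c) ≟ c)      ≡⟨ ∑-cong m (λ u _ → block u) ⟩
  ∑[ u < m ] 𝟙 (coprime? u m)                                ≡⟨ φ≡∑𝟙 m ⟨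
  φ m                                                        ∎
  where
  open ≡-Reasoning
  gcd[u*c,m*c] : ∀ u → gcd (u * c + 0) (m * c) ≡ c * gcd u m
  gcd[u*c,m*c] u = trans (cong₂ gcd (trans (+-identityʳ (u * c)) (*-comm u c)) (*-comm m c))
                         (sym (c*gcd[m,n]≡gcd[cm,cn] c u m))
  gcd≡c⇒coprime : ∀ u → gcd (u * c + 0) (m * c) ≡ c → Coprime u m
  gcd≡c⇒coprime u gcd≡c =
    gcd≡1⇒coprime (*-cancelˡ-≡ _ 1 c (trans (sym (gcd[u*c,m*c] u)) (trans gcd≡c (sym (*-identityʳ c)))))
  coprime⇒gcd≡c : ∀ u → Coprime u m → gcd (u * c + 0) (m * c) ≡ c
  coprime⇒gcd≡c u u⊥m = trans (gcd[u*c,m*c] u) (trans (cong (c *_) (coprime⇒gcd≡1 u⊥m)) (*-identityʳ c))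
  gcd≢c : ∀ u r → r < c′ → gcd (u * c + suc r) (m * c) ≢ c
  gcd≢c u r r<c′ gcd≡c = <⇒≱ (s<s r<c′) (∣⇒≤ (∣m+n∣m⇒∣n c∣x (n∣m*n u)))
    where
    c∣x : c ∣ u * c + suc r
    c∣x = subst (_∣ u * c + suc r) gcd≡c (gcd[m,n]∣m _ _)
  block : ∀ u → ∑[ r < c ] 𝟙 (gcd (u * c + r) (m * c) ≟ c) ≡ 𝟙 (coprime? u m)
  block u = begin
    𝟙 (gcd (u * c + 0) (m * c) ≟ c) + ∑[ r < c′ ] 𝟙 (gcd (u * c + suc r) (m * c) ≟ c)
      ≡⟨ cong₂ _+_ (𝟙-cong (gcd (u * c + 0) (m * c) ≟ c) (coprime? u m) (gcd≡c⇒coprime u) (coprime⇒gcd≡c u))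
                   (∑-cong c′ λ r r<c′ → 𝟙-no (gcd (u * c + suc r) (m * c) ≟ c) (gcd≢c u r r<c′)) ⟩
    𝟙 (coprime? u m) + ∑[ _ < c′ ] 0
      ≡⟨ cong (𝟙 (coprime? u m) +_) (trans (∑-const c′ 0) (*-zeroʳ c′)) ⟩
    𝟙 (coprime? u m) + 0
      ≡⟨ +-identityʳ _ ⟩
    𝟙 (coprime? u m)  ∎

-- Products of sublists of primes

product-∣-⊆ : {xs ys : List ℕ} → xs ⊆ ys → product xs ∣ product ys
product-∣-⊆ []               = ∣-refl
product-∣-⊆ (y ∷ʳ xs⊆ys)     = ∣n⇒∣m*n y (product-∣-⊆ xs⊆ys)
product-∣-⊆ {y ∷ _} (refl ∷ xs⊆ys) = *-monoʳ-∣ y (product-∣-⊆ xs⊆ys)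

product-<-⊆ : {xs ys : List ℕ} → All Prime ys → xs ⊆ ys → length xs < length ys → product xs < product ys
product-<-⊆ {xs} {y ∷ ys} (y-prime ∷ ys-prime) (_ ∷ʳ xs⊆ys) _ = begin-strict
  product xs  ≤⟨ ∣⇒≤ {{productOfPrimes≢0 ys-prime}} (product-∣-⊆ xs⊆ys) ⟩
  product ys  <⟨ m<m*n _ y {{productOfPrimes≢0 ys-prime}} (prime⇒>1 y-prime) ⟩
  product ys * y ≡⟨ *-comm (product ys) y ⟩
  y * product ys ∎
  where open ≤-Reasoning
product-<-⊆ {y ∷ _} (y-prime ∷ ys-prime) (refl ∷ xs⊆ys) (s<s lt) =
  *-monoʳ-< y {{prime⇒nonZero y-prime}} (product-<-⊆ ys-prime xs⊆ys lt)

∣product⇒⊆ : ∀ {d} {ys : List ℕ} → All Prime ys → d ∣ product ys → Σ[ xs ∈ List ℕ ] xs ⊆ ys × product xs ≡ d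
∣product⇒⊆ {ys = []} [] d∣1 = [] , [] , sym (∣1⇒≡1 d∣1)
∣product⇒⊆ {d} {y ∷ ys} (y-prime ∷ ys-prime) d∣yY with y ∣? d
... | yes (divides q refl)
  with ∣product⇒⊆ ys-prime (*-cancelˡ-∣ y {{prime⇒nonZero y-prime}} (subst (_∣ y * product ys) (*-comm q y) d∣yY))
...   | xs , xs⊆ys , refl = y ∷ xs , refl ∷ xs⊆ys , *-comm y (product xs)
∣product⇒⊆ {d} {y ∷ ys} (y-prime ∷ ys-prime) d∣yY | no y∤d
  with ∣product⇒⊆ ys-prime (coprime-divisor (∤⇒coprime y-prime y∤d) d∣yY)
...   | xs , xs⊆ys , eq = xs , y ∷ʳ xs⊆ys , eq

proper-multiple⇒⊂ : ∀ {es c d n} .{{_ : NonZero n}} → All Prime es → product es * c ≡ n →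
                    c ∣ d → d ∣ n → d ≢ c →
                    Σ[ es′ ∈ List ℕ ] es′ ⊆ es × length es′ < length es × product es′ * d ≡ n
proper-multiple⇒⊂ {es} {c} {d} {n} es-prime es*c≡n (divides u refl) (divides q n≡q*d) d≢c
  with ∣product⇒⊆ es-prime q∣es
  where
  instance
    c≢0 : NonZero c
    c≢0 = nonZero-factorʳ {product es} es*c≡n
  q∣es : q ∣ product es
  q∣es = divides u (*-cancelʳ-≡ (product es) (u * q) c (begin
    product es * c  ≡⟨ trans es*c≡n n≡q*d ⟩
    q * (u * c)     ≡⟨ *-assoc q u c ⟨
    q * u * c       ≡⟨ cong (_* c) (*-comm q u) ⟩
    u * q * c       ∎))
    where open ≡-Reasoning
... | es′ , es′⊆es , refl = es′ , es′⊆es , ⊆-length-< es′⊆es es′≢es , sym n≡q*d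
  where
  es′≢es : es′ ≢ es
  es′≢es refl = d≢c (*-cancelˡ-≡ (u * c) c (product es) {{productOfPrimes≢0 es-prime}}
                                (trans (sym n≡q*d) (sym es*c≡n)))

-- For a factorization ds of n this is ∑ᵢ φ (n / (d₁ ⋯ dᵢ)).
suffixTotients : List ℕ → ℕ
suffixTotients []       = φ 1
suffixTotients (p ∷ ps) = φ (product (p ∷ ps)) + suffixTotients ps

φ[product]≤suffixTotients : ∀ ps → φ (product ps) ≤ suffixTotients ps
φ[product]≤suffixTotients []      = ≤-refl
φ[product]≤suffixTotients (_ ∷ _) = m≤m+n _ _

φ-mono-⊆ : {xs ys : List ℕ} → All Prime ys → xs ⊆ ys → ∀ a → φ (a * product xs) ≤ φ (a * product ys)
φ-mono-⊆ [] [] a = ≤-refl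
φ-mono-⊆ {xs} {y ∷ ys} (y-prime ∷ ys-prime) (_ ∷ʳ xs⊆ys) a = begin
  φ (a * product xs)        ≤⟨ φ-mono-⊆ ys-prime xs⊆ys a ⟩
  φ (a * product ys)        ≤⟨ φ[t]≤φ[q*t] y-prime (a * product ys) ⟩
  φ (y * (a * product ys))  ≡⟨ cong φ (*-left-comm y a (product ys)) ⟩
  φ (a * (y * product ys))  ∎
  where open ≤-Reasoning
φ-mono-⊆ {y ∷ xs} {y ∷ ys} (_ ∷ ys-prime) (refl ∷ xs⊆ys) a = begin
  φ (a * (y * product xs))  ≡⟨ cong φ (*-assoc a y (product xs)) ⟨
  φ (a * y * product xs)    ≤⟨ φ-mono-⊆ ys-prime xs⊆ys (a * y) ⟩
  φ (a * y * product ys)    ≡⟨ cong φ (*-assoc a y (product ys)) ⟩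
  φ (a * (y * product ys))  ∎
  where open ≤-Reasoning

suffixTotients-mono-⊆ : {xs ys : List ℕ} → All Prime ys → xs ⊆ ys → suffixTotients xs ≤ suffixTotients ys
suffixTotients-mono-⊆ [] [] = ≤-refl
suffixTotients-mono-⊆ (_ ∷ ys-prime) (_ ∷ʳ xs⊆ys) =
  ≤-trans (suffixTotients-mono-⊆ ys-prime xs⊆ys) (m≤n+m _ _)
suffixTotients-mono-⊆ {y ∷ _} (_ ∷ ys-prime) (refl ∷ xs⊆ys) =
  +-mono-≤ (φ-mono-⊆ ys-prime xs⊆ys y) (suffixTotients-mono-⊆ ys-prime xs⊆ys)

-- y ∏ xs arises from ∏ ys by replacing a missing prime z ≥ y with y and dropping the
-- remaining missing primes; neither step increases φ.
φ-cons-min-⊂ : ∀ {y} {xs ys : List ℕ} → Prime y → All Prime ys → All (y ≤_) ys →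
               xs ⊆ ys → length xs < length ys → ∀ a → φ (a * (y * product xs)) ≤ φ (a * product ys)
φ-cons-min-⊂ {y} {xs} {z ∷ ys} y-prime (z-prime ∷ ys-prime) (y≤z ∷ _) (_ ∷ʳ xs⊆ys) _ a = begin
  φ (a * (y * product xs))   ≡⟨ cong φ (*-left-comm a y (product xs)) ⟩
  φ (y * (a * product xs))   ≤⟨ φ[p*t]≤φ[q*t] z-prime y≤z (a * product xs) ⟩
  φ (z * (a * product xs))   ≡⟨ cong φ (*-left-comm z a (product xs)) ⟩
  φ (a * (z * product xs))   ≤⟨ φ-mono-⊆ (z-prime ∷ ys-prime) (refl ∷ xs⊆ys) a ⟩
  φ (a * (z * product ys))   ∎
  where open ≤-Reasoning
φ-cons-min-⊂ {y} {z ∷ xs} {z ∷ ys} y-prime (_ ∷ ys-prime) (_ ∷ y≤ys) (refl ∷ xs⊆ys) (s<s lt) a = begin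
  φ (a * (y * (z * product xs)))  ≡⟨ cong (λ m → φ (a * m)) (*-left-comm y z (product xs)) ⟩
  φ (a * (z * (y * product xs)))  ≡⟨ cong φ (*-assoc a z _) ⟨
  φ (a * z * (y * product xs))    ≤⟨ φ-cons-min-⊂ y-prime ys-prime y≤ys xs⊆ys lt (a * z) ⟩
  φ (a * z * product ys)          ≡⟨ cong φ (*-assoc a z (product ys)) ⟩
  φ (a * (z * product ys))        ∎
  where open ≤-Reasoning

suffixTotients-⊂ : {xs ys : List ℕ} → All Prime ys → AllPairs _≤_ ys → xs ⊆ ys → length xs < length ys →
                   φ (product ys) + suffixTotients xs ≤ suffixTotients ys
suffixTotients-⊂ (_ ∷ ys-prime) _ (_ ∷ʳ xs⊆ys) _ =
  +-monoʳ-≤ _ (suffixTotients-mono-⊆ ys-prime xs⊆ys)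
suffixTotients-⊂ {z ∷ xs} {z ∷ ys} (z-prime ∷ ys-prime) (z≤ys ∷ ys-sorted) (refl ∷ xs⊆ys) (s<s lt) = begin
  φ (z * product ys) + (φ (z * product xs) + suffixTotients xs)
    ≤⟨ +-monoʳ-≤ (φ (z * product ys)) (+-monoˡ-≤ (suffixTotients xs) φ[z*xs]≤φ[ys]) ⟩
  φ (z * product ys) + (φ (product ys) + suffixTotients xs)
    ≤⟨ +-monoʳ-≤ (φ (z * product ys)) (suffixTotients-⊂ ys-prime ys-sorted xs⊆ys lt) ⟩
  φ (z * product ys) + suffixTotients ys  ∎
  where
  open ≤-Reasoning
  φ[z*xs]≤φ[ys] : φ (z * product xs) ≤ φ (product ys)
  φ[z*xs]≤φ[ys] = subst₂ (λ u v → φ u ≤ φ v) (*-identityˡ (z * product xs)) (*-identityˡ (product ys))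
                         (φ-cons-min-⊂ z-prime ys-prime z≤ys xs⊆ys lt 1)

suffixTotients-tabulate : ∀ ds →
  sum (tabulate (λ (i : Fin (suc (length ds))) → φ (product (drop (toℕ i) ds)))) ≡ suffixTotients ds
suffixTotients-tabulate []       = +-identityʳ (φ 1)
suffixTotients-tabulate (d ∷ ds) = cong (φ (d * product ds) +_) (suffixTotients-tabulate ds)

-- Divisor chains

module _ {V : Set} (ι : V → ℕ) {n : ℕ} .{{_ : NonZero n}} (ι∣n : ∀ x → ι x ∣ n)
         (fibre-bound : ∀ m {c xs} → m * c ≡ n → Unique xs → All (λ x → ι x ≡ c) xs → length xs ≤ φ m)
         where

  chain-bound : ∀ {es c} {P : List V} → Acc _<_ (length es) → All Prime es → AllPairs _≤_ es →
                product es * c ≡ n → Unique P → AllPairs (λ x y → ι x ∣ ι y) P → All (λ x → c ∣ ι x) P →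
                length P ≤ suffixTotients es
  chain-bound {es} {c} {P} (acc smaller) es-prime es-sorted es*c≡n P-unique P-chain c∣P = begin
    length P                     ≡⟨ length-filter+∁ at-c? P ⟨
    length bottom + length rest  ≤⟨ higher rest (Uniqueₚ.filter⁺ (∁? at-c?) P-unique)
                                                (AllPairsₚ.filter⁺ (∁? at-c?) P-chain)
                                                (All.zip (Allₚ.filter⁺ (∁? at-c?) c∣P , Allₚ.all-filter (∁? at-c?) P)) ⟩
    suffixTotients es            ∎
    where
    open ≤-Reasoning
    at-c? : Decidable (λ x → ι x ≡ c)
    at-c? x = ι x ≟ c
    bottom rest : List V
    bottom = filter at-c? P
    rest   = filter (∁? at-c?) P
    |bottom|≤φ : length bottom ≤ φ (product es)
    |bottom|≤φ = fibre-bound (product es) es*c≡n (Uniqueₚ.filter⁺ at-c? P-unique) (Allₚ.all-filter at-c? P)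
    higher : ∀ Q → Unique Q → AllPairs (λ x y → ι x ∣ ι y) Q → All (λ x → c ∣ ι x × ι x ≢ c) Q →
             length bottom + length Q ≤ suffixTotients es
    higher [] _ _ _ = begin
      length bottom + 0  ≡⟨ +-identityʳ _ ⟩
      length bottom      ≤⟨ |bottom|≤φ ⟩
      φ (product es)     ≤⟨ φ[product]≤suffixTotients es ⟩
      suffixTotients es  ∎
    higher Q@(y ∷ _) Q-unique Q-chain ((c∣y , y≢c) ∷ _)
      with proper-multiple⇒⊂ es-prime es*c≡n c∣y (ι∣n y) y≢c
    ... | es′ , es′⊆es , es′<es , es′*y≡n = begin
      length bottom + length Q             ≤⟨ +-mono-≤ |bottom|≤φ |Q|≤ ⟩
      φ (product es) + suffixTotients es′  ≤⟨ suffixTotients-⊂ es-prime es-sorted es′⊆es es′<es ⟩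
      suffixTotients es                    ∎
      where
      |Q|≤ : length Q ≤ suffixTotients es′
      |Q|≤ = chain-bound (smaller es′<es) (All-resp-⊆ es′⊆es es-prime) (AllPairs-resp-⊆ es′⊆es es-sorted)
                         es′*y≡n Q-unique Q-chain (∣-refl ∷ AllPairs.head Q-chain)

-- The power graph of ℤ/nℤ

*-%-congʳ : ∀ w {a b n} .{{_ : NonZero n}} → a % n ≡ b % n → (w * a) % n ≡ (w * b) % n
*-%-congʳ w {a} {b} {n} a≡b = begin
  (w * a) % n                ≡⟨ %-distribˡ-* w a n ⟩
  ((w % n) * (a % n)) % n    ≡⟨ cong (λ v → ((w % n) * v) % n) a≡b ⟩
  ((w % n) * (b % n)) % n    ≡⟨ %-distribˡ-* w b n ⟨
  (w * b) % n                ∎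
  where open ≡-Reasoning

bézout-% : ∀ m n .{{_ : NonZero n}} → Σ[ k ∈ ℕ ] (k * m) % n ≡ gcd m n % n
bézout-% m n with Bézout.identity (gcd-GCD m n)
... | Bézout.+- a b g+bn≡am = a , (begin
  (a * m) % n           ≡⟨ cong (_% n) g+bn≡am ⟨
  (gcd m n + b * n) % n ≡⟨ [m+kn]%n≡m%n (gcd m n) b n ⟩
  gcd m n % n           ∎)
  where open ≡-Reasoning
... | Bézout.-+ a b g+am≡bn = a * pred n , (begin
  (a * pred n * m) % n                         ≡⟨ [m+kn]%n≡m%n (a * pred n * m) b n ⟨
  (a * pred n * m + b * n) % n                 ≡⟨ cong (λ v → (a * pred n * m + v) % n) g+am≡bn ⟨
  (a * pred n * m + (gcd m n + a * m)) % n     ≡⟨ cong (_% n) (rearrange a (pred n) m (gcd m n)) ⟩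
  (gcd m n + (a * m) * suc (pred n)) % n       ≡⟨ cong (λ v → (gcd m n + (a * m) * v) % n) (suc-pred n) ⟩
  (gcd m n + (a * m) * n) % n                  ≡⟨ [m+kn]%n≡m%n (gcd m n) (a * m) n ⟩
  gcd m n % n                                  ∎)
  where
  open ≡-Reasoning
  rearrange : ∀ a p m g → a * p * m + (g + a * m) ≡ g + (a * m) * suc p
  rearrange = solve-∀

module PowerGraph (n : ℕ) .{{_ : NonZero n}} where

  -- ⟨x⟩ = gcd x n ℤ/nℤ, the subgroup of index gcd x n.
  index : Fin n → ℕ
  index x = gcd (toℕ x) n

  index∣n : ∀ x → index x ∣ n
  index∣n x = gcd[m,n]∣n (toℕ x) n

  InCyclic⇔index∣ : ∀ {x z} → InCyclic n x z ⇔ index x ∣ toℕ z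
  InCyclic⇔index∣ {x} {z} = mk⇔ to from
    where
    to : InCyclic n x z → index x ∣ toℕ z
    to (k , kx%n≡z) = subst (index x ∣_) kx%n≡z (%-presˡ-∣ (∣n⇒∣m*n k (gcd[m,n]∣m (toℕ x) n)) (index∣n x))
    from : index x ∣ toℕ z → InCyclic n x z
    from (divides w z≡w*index) with bézout-% (toℕ x) n
    ... | k , kx≡index = w * k , (begin
      (w * k * toℕ x) % n     ≡⟨ cong (_% n) (*-assoc w k (toℕ x)) ⟩
      (w * (k * toℕ x)) % n   ≡⟨ *-%-congʳ w kx≡index ⟩
      (w * index x) % n       ≡⟨ cong (_% n) z≡w*index ⟨
      toℕ z % n               ≡⟨ m<n⇒m%n≡m (toℕ<n z) ⟩
      toℕ z                   ∎)
      where open ≡-Reasoning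

  ∈⟨self⟩ : ∀ x → InCyclic n x x
  ∈⟨self⟩ x = Equivalence.from InCyclic⇔index∣ (gcd[m,n]∣m (toℕ x) n)

  Edge⇔ : ∀ {x y} → Edge n x y ⇔ (x ≢ y × index x ∣ index y)
  Edge⇔ {x} {y} = mk⇔
    (λ (x≢y , ⟨y⟩⊆⟨x⟩) → x≢y , gcd-greatest (to (⟨y⟩⊆⟨x⟩ y (∈⟨self⟩ y))) (index∣n x))
    (λ (x≢y , x∣y) → x≢y , λ z z∈⟨y⟩ → from (∣-trans x∣y (to z∈⟨y⟩)))
    where
    to : ∀ {x z} → InCyclic n x z → index x ∣ toℕ z
    to = Equivalence.to InCyclic⇔index∣
    from : ∀ {x z} → index x ∣ toℕ z → InCyclic n x z
    from = Equivalence.from InCyclic⇔index∣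

  IsGenOf⇔index≡ : ∀ {d x} → d ∣ n → IsGenOf n d x ⇔ index x ≡ d
  IsGenOf⇔index≡ {d} {x} d∣n = mk⇔ to from
    where
    from : index x ≡ d → IsGenOf n d x
    from refl z = InCyclic⇔index∣
    to : IsGenOf n d x → index x ≡ d
    to ⟨x⟩≡dℤ = ∣-antisym index∣d (gcd-greatest (Equivalence.to (⟨x⟩≡dℤ x) (∈⟨self⟩ x)) d∣n)
      where
      index∣d : index x ∣ d
      index∣d with d <? n
      ... | yes d<n = subst (index x ∣_) (toℕ-fromℕ< d<n)
                        (Equivalence.to InCyclic⇔index∣
                          (Equivalence.from (⟨x⟩≡dℤ (fromℕ< d<n)) (∣-reflexive (sym (toℕ-fromℕ< d<n)))))
      ... | no d≮n  = subst (index x ∣_) (≤-antisym (≮⇒≥ d≮n) (∣⇒≤ d∣n)) (index∣n x)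

  IsDirectedPath⇔ : ∀ {P} → IsDirectedPath n P ⇔ (Unique P × AllPairs (λ x y → index x ∣ index y) P)
  IsDirectedPath⇔ = mk⇔
    (λ (P-unique , P-linked) →
       P-unique , Linked⇒AllPairs ∣-trans (Linked.map (proj₂ ∘ Equivalence.to Edge⇔) P-linked))
    (λ (P-unique , P-chain) →
       P-unique , AllPairs⇒Linked (AllPairs.map (Equivalence.from Edge⇔) (AllPairs.zip (P-unique , P-chain))))

  generators : ℕ → List (Fin n)
  generators d = filter (λ x → index x ≟ d) (allFin n)

  generators-unique : ∀ d → Unique (generators d)
  generators-unique d = Uniqueₚ.filter⁺ (λ x → index x ≟ d) (Uniqueₚ.allFin⁺ n)

  ∈-generators⇔ : ∀ {d x} → x ∈ generators d ⇔ index x ≡ d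
  ∈-generators⇔ {d} {x} = mk⇔ (proj₂ ∘ ∈-filter⁻ (λ x → index x ≟ d) {xs = allFin n})
                              (∈-filter⁺ (λ x → index x ≟ d) {xs = allFin n} (∈-allFin x))

  length-generators : ∀ m {d} → m * d ≡ n → length (generators d) ≡ φ m
  length-generators m {d} m*d≡n = begin
    length (filter (λ x → index x ≟ d) (allFin n))
      ≡⟨ length-filter-allFin (λ x → gcd x n ≟ d) n ⟩
    length (filter (λ x → gcd x n ≟ d) (upTo n))
      ≡⟨ cong (λ N → length (filter (λ x → gcd x N ≟ d) (upTo N))) m*d≡n ⟨
    length (filter (λ x → gcd x (m * d) ≟ d) (upTo (m * d)))
      ≡⟨ #[gcd≡c]≡φ m d {{nonZero-factorʳ {m} m*d≡n}} ⟩
    φ m  ∎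
    where open ≡-Reasoning

  Unique-index≡⇒length-≤ : ∀ m {d xs} → m * d ≡ n → Unique xs → All (λ x → index x ≡ d) xs → length xs ≤ φ m
  Unique-index≡⇒length-≤ m {xs = xs} m*d≡n xs-unique xs-index =
    subst (length xs ≤_) (length-generators m m*d≡n)
          (Unique⇒length-≤ xs-unique (Equivalence.from ∈-generators⇔ ∘ All.lookup xs-index))

-- Longest directed paths

m*n-div-n≡m : ∀ m d .{{_ : NonZero d}} → (m * d) div d ≡ m
m*n-div-n≡m m (suc d) = m*n/n≡m m (suc d)

module LongestPaths {n : ℕ} .{{_ : NonZero n}} {ds : List ℕ} (factorization : IsPrimeFactorization ds n) where

  open PowerGraph n public

  private
    ds-prime : All Prime ds
    ds-prime = proj₁ factorization
    ds-sorted : AllPairs _≤_ ds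
    ds-sorted = Linked⇒AllPairs ≤-trans (proj₁ (proj₂ factorization))
    ∏ds≡n : product ds ≡ n
    ∏ds≡n = proj₂ (proj₂ factorization)

  -- Block i lists the generators of the subgroup of index level i = d₁ ⋯ dᵢ,
  -- whose order is colevel i = dᵢ₊₁ ⋯ dₖ.
  level : Fin (suc (length ds)) → ℕ
  level = prefixProd ds

  colevel : Fin (suc (length ds)) → ℕ
  colevel i = product (drop (toℕ i) ds)

  colevel*level≡n : ∀ i → colevel i * level i ≡ n
  colevel*level≡n i = begin
    colevel i * level i                                     ≡⟨ *-comm (colevel i) (level i) ⟩
    product (take (toℕ i) ds) * product (drop (toℕ i) ds)   ≡⟨ product-++ (take (toℕ i) ds) _ ⟨
    product (take (toℕ i) ds ++ drop (toℕ i) ds)            ≡⟨ cong product (take++drop≡id (toℕ i) ds) ⟩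
    product ds                                              ≡⟨ ∏ds≡n ⟩
    n                                                       ∎
    where open ≡-Reasoning

  level∣n : ∀ i → level i ∣ n
  level∣n i = divides (colevel i) (sym (colevel*level≡n i))

  n-div-level : ∀ i → n div level i ≡ colevel i
  n-div-level i = trans (cong (_div level i) (sym (colevel*level≡n i)))
                        (m*n-div-n≡m (colevel i) (level i) {{productOfPrimes≢0 (Allₚ.take⁺ (toℕ i) ds-prime)}})

  level-∣ : ∀ {i j} → toℕ i ≤ toℕ j → level i ∣ level j
  level-∣ i≤j = product-∣-⊆ (take⁺ i≤j)

  level-< : ∀ {i j} → toℕ i < toℕ j → level i < level j
  level-< {i} {j} i<j = product-<-⊆ (Allₚ.take⁺ (toℕ j) ds-prime) (take⁺ (<⇒≤ i<j))
    (subst₂ _<_ (sym (length-prefix i)) (sym (length-prefix j)) i<j)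
    where
    length-prefix : ∀ k → length (take (toℕ k) ds) ≡ toℕ k
    length-prefix k = trans (length-take (toℕ k) ds) (m≤n⇒m⊓n≡m (s≤s⁻¹ (toℕ<n k)))

  generators-BlocksOk : BlocksOk n ds (generators ∘ level)
  generators-BlocksOk i = generators-unique (level i) , λ x → mk⇔
    (Equivalence.from (IsGenOf⇔index≡ (level∣n i)) ∘ Equivalence.to ∈-generators⇔)
    (Equivalence.from ∈-generators⇔ ∘ Equivalence.to (IsGenOf⇔index≡ (level∣n i)))

  IsDirectedPath⇒length≤ : ∀ P → IsDirectedPath n P → length P ≤ suffixTotients ds
  IsDirectedPath⇒length≤ P P-path with Equivalence.to IsDirectedPath⇔ P-path
  ... | P-unique , P-chain =
    chain-bound index index∣n Unique-index≡⇒length-≤ (<-wellFounded (length ds)) ds-prime ds-sorted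
                (trans (*-identityʳ (product ds)) ∏ds≡n) P-unique P-chain (All.universal (λ _ → 1∣ _) P)

  module _ {blocks : Fin (suc (length ds)) → List (Fin n)} (ok : BlocksOk n ds blocks) where

    index-block : ∀ i {x} → x ∈ blocks i → index x ≡ level i
    index-block i {x} = Equivalence.to (IsGenOf⇔index≡ (level∣n i)) ∘ Equivalence.to (proj₂ (ok i) x)

    length-block : ∀ i → length (blocks i) ≡ φ (n div level i)
    length-block i = begin
      length (blocks i)              ≡⟨ ≤-antisym (Unique⇒length-≤ (proj₁ (ok i)) block⊆generators)
                                                  (Unique⇒length-≤ (generators-unique (level i)) generators⊆block) ⟩
      length (generators (level i))  ≡⟨ length-generators (colevel i) (colevel*level≡n i) ⟩
      φ (colevel i)                  ≡⟨ cong φ (n-div-level i) ⟨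
      φ (n div level i)              ∎
      where
      open ≡-Reasoning
      block⊆generators : ∀ {x} → x ∈ blocks i → x ∈ generators (level i)
      block⊆generators = Equivalence.from ∈-generators⇔ ∘ index-block i
      generators⊆block : ∀ {x} → x ∈ generators (level i) → x ∈ blocks i
      generators⊆block {x} = Equivalence.from (proj₂ (ok i) x) ∘ Equivalence.from (IsGenOf⇔index≡ (level∣n i))
                             ∘ Equivalence.to ∈-generators⇔

    pathOf-isDirectedPath : IsDirectedPath n (pathOf blocks)
    pathOf-isDirectedPath = Equivalence.from IsDirectedPath⇔
      (AllPairs.unzip (AllPairsₚ.concat⁺ (Allₚ.tabulate⁺ within) (AllPairsₚ.tabulate⁺-< across)))
      where
      within : ∀ i → AllPairs (λ x y → x ≢ y × index x ∣ index y) (blocks i)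
      within i = AllPairs.zipWith (λ (x≢y , x-level , y-level) → x≢y , ∣-reflexive (trans x-level (sym y-level)))
                                  (proj₁ (ok i) , All⇒AllPairs (All.tabulate (index-block i)))
      across : ∀ {i j} → toℕ i < toℕ j → All (λ x → All (λ y → x ≢ y × index x ∣ index y) (blocks j)) (blocks i)
      across {i} {j} i<j = All.tabulate λ x∈i → All.tabulate λ y∈j →
        (λ { refl → <⇒≢ (level-< i<j) (trans (sym (index-block i x∈i)) (index-block j y∈j)) }) ,
        subst₂ _∣_ (sym (index-block i x∈i)) (sym (index-block j y∈j)) (level-∣ (<⇒≤ i<j))

    length-pathOf : length (pathOf blocks) ≡ suffixTotients ds
    length-pathOf = begin
      length (concat (tabulate blocks))    ≡⟨ length-concat (tabulate blocks) ⟩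
      sum (map length (tabulate blocks))   ≡⟨ cong sum (map-tabulate blocks length) ⟩
      sum (tabulate (length ∘ blocks))     ≡⟨ cong sum (tabulate-cong λ i →
                                                 trans (length-block i) (cong φ (n-div-level i))) ⟩
      sum (tabulate (φ ∘ colevel))         ≡⟨ suffixTotients-tabulate ds ⟩
      suffixTotients ds                    ∎
      where open ≡-Reasoning

theorem5 : (n : ℕ) .{{_ : NonZero n}} (ds : List ℕ) →
    IsPrimeFactorization ds n →
    (∃[ blocks ] BlocksOk n ds blocks) ×
    (∀ blocks → BlocksOk n ds blocks →
      IsDirectedPath n (pathOf blocks) ×
      (∀ P → IsDirectedPath n P → length P ≤ length (pathOf blocks)) ×
      (∀ i → length (blocks i) ≡ φ (n div prefixProd ds i)))
theorem5 n ds factorization =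
  (generators ∘ level , generators-BlocksOk) ,
  λ blocks ok → pathOf-isDirectedPath ok ,
                (λ P P-path → subst (length P ≤_) (sym (length-pathOf ok)) (IsDirectedPath⇒length≤ P P-path)) ,
                length-block ok
  where open LongestPaths factorization
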